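{- Let $P$ be a finite poset, $A$ a sub-digraph of $P$, and $D,D'\in\mathcal{D}(P)$. Then $D$ and $D'$ are adjacent in $G(P,A)$ if and only if for all $x,y\in P$: (1) if $x\in D$ and $(y,x)\in\overline{A}$ then $y\in D'$; and (2) if $x\in D'$ and $(y,x)\in\overline{A}$ then $y\in D$.
   Context: A poset $P$ is viewed as a reflexive digraph with an arc $(a,b)$ whenever $a\le b$ (including loops). A sub-digraph $A$ of $P$ has the same vertex set and a subset of the arcs; $\overline{A}$ is the sub-digraph of $P$ whose arcs are the arcs of $P$ not in $A$. $\mathcal{D}(P)$ is the set of downsets of $P$. The graph $G(P,A)$ has vertex set $\mathcal{D}(P)$, with $D\sim D'$ iff $A$ contains every arc $(x,y)$ of $P$ for which $x,y$ both lie in $D\setminus D'$ or both lie in $D'\setminus D$. -}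

module Defs where

open import Data.Nat using (ℕ)
open import Data.Fin using (Fin)
open import Data.Fin.Subset using (Subset; _∈_; _∉_)
open import Data.Product using (_×_)
open import Data.Sum using (_⊎_)
open import Relation.Nullary using (¬_)
open import Relation.Binary.Core using (Rel)
open import Relation.Binary.Definitions using (Decidable)
open import Relation.Binary.PropositionalEquality using (_≡_)
open import Relation.Binary.Structures using (IsDecPartialOrder)
open import Level using (0ℓ)

record FinPoset : Set₁ where
  field
    n     : ℕ
    _≤_   : Rel (Fin n) 0ℓ
    isDPO : IsDecPartialOrder _≡_ _≤_

-- A sub-digraph of P (as reflexive digraph with arcs (a,b) for a ≤ b):
-- a (decidable) set of arcs contained in the arcs of P.
record SubDigraph (P : FinPoset) : Set₁ where
  open FinPoset P
  field
    arc    : Rel (Fin n) 0ℓ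
    arc?   : Decidable arc
    arc⊆P  : ∀ {x y} → arc x y → x ≤ y

module _ {P : FinPoset} where
  open FinPoset P

  coArc : SubDigraph P → Fin n → Fin n → Set
  coArc A x y = (x ≤ y) × ¬ SubDigraph.arc A x y

  IsDownset : Subset n → Set
  IsDownset D = ∀ {x y} → y ≤ x → x ∈ D → y ∈ D

  InDiff : Subset n → Subset n → Fin n → Set
  InDiff D D' x = (x ∈ D) × (x ∉ D')

  Adjacent : SubDigraph P → Subset n → Subset n → Set
  Adjacent A D D' = ∀ x y → x ≤ y →
    (InDiff D D' x × InDiff D D' y) ⊎ (InDiff D' D x × InDiff D' D y) →
    SubDigraph.arc A x y

-- Both conditions are one-sided views of the same fact for the pair (D, D′)
-- and its swap (D′, D). An Ā-arc y → x with x ∈ D and y ∉ D′ would lie inside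
-- D ∖ D′, since downward closure gives y ∈ D and x ∉ D′; conversely an arc of
-- P inside D ∖ D′ missing from A is such an Ā-arc.
module Submission where

open import Defs
open import Data.Fin using (Fin)
open import Data.Fin.Subset using (Subset; _∈_)
open import Data.Fin.Subset.Properties using (_∈?_)
open import Data.Product using (_×_; _,_; proj₁; proj₂; uncurry)
open import Data.Sum using (inj₁; [_,_]; swap)
open import Data.Empty using (⊥-elim)
open import Relation.Nullary using (yes; no)
open import Function.Bundles using (_⇔_; mk⇔)

module _ {P : FinPoset} (A : SubDigraph P) where
  open FinPoset P
  open SubDigraph A

  CoArcClosed : Subset n → Subset n → Set
  CoArcClosed D D′ = ∀ x y → x ∈ D → coArc {P} A y x → y ∈ D′

  Adjacent-sym : ∀ {D D′} → Adjacent {P} A D D′ → Adjacent {P} A D′ D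
  Adjacent-sym adj x y x≤y inDiffs = adj x y x≤y (swap inDiffs)

  adjacent⇒coArcClosed : ∀ {D D′} → IsDownset {P} D → IsDownset {P} D′ →
                         Adjacent {P} A D D′ → CoArcClosed D D′
  adjacent⇒coArcClosed {D} {D′} dD dD′ adj x y x∈D (y≤x , ¬arc) with y ∈? D′
  ... | yes y∈D′ = y∈D′
  ... | no y∉D′ = ⊥-elim (¬arc (adj y x y≤x (inj₁ (y∈D∖D′ , x∈D∖D′))))
    where
    y∈D∖D′ : InDiff {P} D D′ y
    y∈D∖D′ = dD y≤x x∈D , y∉D′
    x∈D∖D′ : InDiff {P} D D′ x
    x∈D∖D′ = x∈D , λ x∈D′ → y∉D′ (dD′ y≤x x∈D′)

  coArcClosed⇒arc : ∀ {D D′ x y} → CoArcClosed D D′ → x ≤ y →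
                    InDiff {P} D D′ x → InDiff {P} D D′ y → arc x y
  coArcClosed⇒arc {x = x} {y} closed x≤y (_ , x∉D′) (y∈D , _) with arc? x y
  ... | yes a = a
  ... | no ¬a = ⊥-elim (x∉D′ (closed y x y∈D (x≤y , ¬a)))

lemma4p2 : (P : FinPoset) (A : SubDigraph P)
           (D D' : Subset (FinPoset.n P)) →
           IsDownset {P} D → IsDownset {P} D' →
           Adjacent {P} A D D' ⇔
           ((∀ (x y : Fin (FinPoset.n P)) →
               (x ∈ D → coArc {P} A y x → y ∈ D') ×
               (x ∈ D' → coArc {P} A y x → y ∈ D)))
lemma4p2 P A D D' dD dD' = mk⇔ to from
  where
  open FinPoset P using (n)

  BothCoArcClosed : Set
  BothCoArcClosed = ∀ (x y : Fin n) →
    (x ∈ D → coArc {P} A y x → y ∈ D') × (x ∈ D' → coArc {P} A y x → y ∈ D)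

  to : Adjacent {P} A D D' → BothCoArcClosed
  to adj x y = adjacent⇒coArcClosed A dD dD' adj x y
             , adjacent⇒coArcClosed A dD' dD (Adjacent-sym A adj) x y

  from : BothCoArcClosed → Adjacent {P} A D D'
  from closed x y x≤y =
    [ uncurry (coArcClosed⇒arc A (λ u v → proj₁ (closed u v)) x≤y)
    , uncurry (coArcClosed⇒arc A (λ u v → proj₂ (closed u v)) x≤y) ]
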